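{- Let $\mathcal R$ be a set of rewrite rules. If $\to_{\mathcal R}$ is locally confluent on the set $\mathcal T(\mathcal F,\mathcal X)$ of algebraic terms, then $\to\;=\;\to_{\mathcal R}\cup\to_\beta$ is locally confluent on the set $\mathcal T$ of all terms.
   Context: Terms (set $\mathcal T$) are built from sorts, variables (from disjoint infinite sets $\mathcal X^s$ indexed by sorts), dependent products $(x:t)u$, abstractions $[x:t]u$, applications $tu$, and $f(t_1,\dots,t_n)$ where $f$ is a symbol of arity $n$ (from a set $\mathcal F$ of symbols with fixed arities); binders $(x:t)$ and $[x:t]$ bind $x$, terms are taken modulo renaming of bound variables. A term is algebraic if it is a variable or of the form $f(t_1,\dots,t_n)$ with all $t_i$ algebraic; $\mathcal T(\mathcal F,\mathcal X)$ is the set of algebraic terms. A rewrite rule is a pair $l\to r$ of terms with $l$ algebraic and not a variable and $\mathrm{FV}(r)\subseteq\mathrm{FV}(l)$. $\to_{\mathcal R}$ is the least relation containing $\mathcal R$ that is stable by substitution and by context; $\to_\beta$ is the least relation stable by substitution and context containing $([x:U]t)\,u\to_\beta t\{x\mapsto u\}$. A relation $\to$ is locally confluent on a set $E$ if whenever $t\in E$, $t\to u$ and $t\to v$, there is $w$ with $u\to^*w$ and $v\to^*w$. -}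

module Defs where

open import Data.Nat using (ℕ; zero; suc)
open import Data.Fin using (Fin)
open import Data.Vec using (Vec; []; _∷_; lookup; _[_]≔_)
open import Data.Product using (Σ; _×_; _,_; ∃)
open import Data.Empty using (⊥)
open import Data.Unit using (⊤)
open import Data.Sum using (_⊎_)
open import Relation.Nullary using (¬_; yes; no)
open import Relation.Binary.PropositionalEquality using (_≡_; refl)
open import Relation.Binary.Construct.Closure.ReflexiveTransitive using (Star)

data Sort : Set where
  ⋆ □ : Sort

_≟S_ : (s s' : Sort) → Relation.Nullary.Dec (s ≡ s')
⋆ ≟S ⋆ = yes refl
⋆ ≟S □ = no (λ ())
□ ≟S ⋆ = no (λ ())
□ ≟S □ = yes refl

-- Variables x ∈ X^s are represented by per-sort de Bruijn indices:
-- 'var s i' denotes the variable of sort s bound by the i-th enclosing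
-- binder of sort s (binders of the other sort are not counted); indices
-- beyond the enclosing binders of sort s denote free variables of X^s.
-- Terms are thereby taken modulo renaming of bound variables.
module Terms (F : Set) (arity : F → ℕ) where

  data Term : Set where
    sort : Sort → Term
    var  : Sort → ℕ → Term
    prod : Sort → Term → Term → Term   -- (x:t)u with x ∈ X^s
    abs  : Sort → Term → Term → Term   -- [x:t]u with x ∈ X^s
    app  : Term → Term → Term
    fun  : (f : F) → Vec Term (arity f) → Term

  Ren : Set
  Ren = Sort → ℕ → ℕ

  Sub : Set
  Sub = Sort → ℕ → Term

  liftR : Sort → Ren → Ren
  liftR s ρ s' i with s' ≟S s
  liftR s ρ s' zero    | yes _ = zero
  liftR s ρ s' (suc j) | yes _ = suc (ρ s' j)
  ... | no _ = ρ s' i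

  mutual
    rename : Ren → Term → Term
    rename ρ (sort s) = sort s
    rename ρ (var s i) = var s (ρ s i)
    rename ρ (prod s t u) = prod s (rename ρ t) (rename (liftR s ρ) u)
    rename ρ (abs s t u) = abs s (rename ρ t) (rename (liftR s ρ) u)
    rename ρ (app t u) = app (rename ρ t) (rename ρ u)
    rename ρ (fun f ts) = fun f (renameV ρ ts)

    renameV : ∀ {n} → Ren → Vec Term n → Vec Term n
    renameV ρ [] = []
    renameV ρ (t ∷ ts) = rename ρ t ∷ renameV ρ ts

  weaken : Sort → Term → Term
  weaken s = rename (λ s' i → shiftIf s' i)
    where
      shiftIf : Sort → ℕ → ℕ
      shiftIf s' i with s' ≟S s
      ... | yes _ = suc i
      ... | no _ = i

  liftS : Sort → Sub → Sub
  liftS s σ s' i with s' ≟S s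
  liftS s σ s' zero    | yes _ = var s' zero
  liftS s σ s' (suc j) | yes _ = weaken s (σ s' j)
  ... | no _ = weaken s (σ s' i)

  mutual
    subst : Sub → Term → Term
    subst σ (sort s) = sort s
    subst σ (var s i) = σ s i
    subst σ (prod s t u) = prod s (subst σ t) (subst (liftS s σ) u)
    subst σ (abs s t u) = abs s (subst σ t) (subst (liftS s σ) u)
    subst σ (app t u) = app (subst σ t) (subst σ u)
    subst σ (fun f ts) = fun f (substV σ ts)

    substV : ∀ {n} → Sub → Vec Term n → Vec Term n
    substV σ [] = []
    substV σ (t ∷ ts) = subst σ t ∷ substV σ ts

  -- t{x ↦ u} where t is the body of a binder of sort s binding x
  -- (x is 'var s 0' in t; the other variables of sort s go down by one)
  single : Sort → Term → Sub
  single s u s' i with s' ≟S s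
  single s u s' zero    | yes _ = u
  single s u s' (suc j) | yes _ = var s' j
  ... | no _ = var s' i

  _[_≔_] : Term → Sort → Term → Term
  t [ s ≔ u ] = subst (single s u) t

  mutual
    data Algebraic : Term → Set where
      var : ∀ s i → Algebraic (var s i)
      fun : ∀ f ts → AlgebraicV ts → Algebraic (fun f ts)

    data AlgebraicV : ∀ {n} → Vec Term n → Set where
      []  : AlgebraicV []
      _∷_ : ∀ {n t} {ts : Vec Term n} → Algebraic t → AlgebraicV ts → AlgebraicV (t ∷ ts)

  up : Sort → Sort → ℕ → ℕ
  up b s i with s ≟S b
  ... | yes _ = suc i
  ... | no _ = i

  data FreeIn (s : Sort) : ℕ → Term → Set where
    var   : ∀ i → FreeIn s i (var s i)
    prodˡ : ∀ {i b t u} → FreeIn s i t → FreeIn s i (prod b t u)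
    prodʳ : ∀ {i b t u} → FreeIn s (up b s i) u → FreeIn s i (prod b t u)
    absˡ  : ∀ {i b t u} → FreeIn s i t → FreeIn s i (abs b t u)
    absʳ  : ∀ {i b t u} → FreeIn s (up b s i) u → FreeIn s i (abs b t u)
    appˡ  : ∀ {i t u} → FreeIn s i t → FreeIn s i (app t u)
    appʳ  : ∀ {i t u} → FreeIn s i u → FreeIn s i (app t u)
    fun   : ∀ {i f ts} (k : Fin (arity f)) → FreeIn s i (lookup ts k) → FreeIn s i (fun f ts)

  IsVar : Term → Set
  IsVar t = Σ Sort λ s → Σ ℕ λ i → t ≡ var s i

  IsRewriteRule : Term → Term → Set
  IsRewriteRule l r =
    Algebraic l × ¬ IsVar l × (∀ s i → FreeIn s i r → FreeIn s i l)

  data Closure (Base : Term → Term → Set) : Term → Term → Set where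
    base  : ∀ {t u} → Base t u → Closure Base t u
    subst⟨_⟩ : ∀ {t u} (σ : Sub) → Closure Base t u → Closure Base (subst σ t) (subst σ u)
    prodˡ : ∀ {s t t' u} → Closure Base t t' → Closure Base (prod s t u) (prod s t' u)
    prodʳ : ∀ {s t u u'} → Closure Base u u' → Closure Base (prod s t u) (prod s t u')
    absˡ  : ∀ {s t t' u} → Closure Base t t' → Closure Base (abs s t u) (abs s t' u)
    absʳ  : ∀ {s t u u'} → Closure Base u u' → Closure Base (abs s t u) (abs s t u')
    appˡ  : ∀ {t t' u} → Closure Base t t' → Closure Base (app t u) (app t' u)
    appʳ  : ∀ {t u u'} → Closure Base u u' → Closure Base (app t u) (app t u')
    fun   : ∀ {f ts u} (k : Fin (arity f)) → Closure Base (lookup ts k) u →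
            Closure Base (fun f ts) (fun f (ts [ k ]≔ u))

  _⟶[_]_ : Term → (Term → Term → Set) → Term → Set
  t ⟶[ R ] u = Closure R t u

  data BetaRoot : Term → Term → Set where
    beta : ∀ s U t u → BetaRoot (app (abs s U t) u) (t [ s ≔ u ])

  _⟶β_ : Term → Term → Set
  _⟶β_ = Closure BetaRoot

  _⟶[_]∪β_ : Term → (Term → Term → Set) → Term → Set
  t ⟶[ R ]∪β u = (t ⟶[ R ] u) ⊎ (t ⟶β u)

  LocallyConfluentOn : (Term → Set) → (Term → Term → Set) → Set
  LocallyConfluentOn E _⟶_ =
    ∀ t → E t → ∀ u v → t ⟶ u → t ⟶ v →
      ∃ λ w → Star _⟶_ u w × Star _⟶_ v w

  AllTerms : Term → Set
  AllTerms _ = ⊤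

-- Closure R and Closure BetaRoot are replaced by the equivalent relation _↝_ of root steps under
-- term constructors, in which the position of a redex is explicit; a peak u ↜ t ↝ v is then split
-- according to the positions of its two redexes.  Redexes at disjoint positions commute.  A redex
-- lying inside the substitution part of a rule or β-redex is joined by reducing all its copies
-- (several steps when the rule is not left-linear).  A β-redex and a rule redex never overlap at a
-- non-variable position, since left-hand sides are algebraic and headed by a symbol.  Finally, if a
-- rule instance σ l has a rule instance τ l' at a non-variable position p of l, then σ (l|p) = τ l'
-- exhibits l|p and l' (renamed apart) as unifiable algebraic terms, and a unification guided by σ
-- and τ yields an algebraic common instance through which both factor.  The peak is thus an
-- instance of a peak of →R from an algebraic term, joinable by hypothesis, and joins are stable
-- under substitution.

module Submission where

open import Defs
open import Data.Nat using (ℕ; zero; suc; _+_; _≤_; _<_; z≤n; s≤s)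
import Data.Nat as ℕ
open import Data.Nat.Properties using (+-assoc; m<n+m; ≤-refl; ≤-reflexive; ≤-trans; m≤m+n; m≤n+m; m≤n⇒m≤1+n; <-irrefl)
open import Data.Nat.Induction using (<-wellFounded)
open import Induction.WellFounded using (Acc; acc)
open import Data.Fin using (Fin; zero; suc)
import Data.Fin.Properties as Fin
open import Data.Vec using (Vec; []; _∷_; lookup; _[_]≔_)
open import Data.Vec.Properties using (∷-injectiveˡ; ∷-injectiveʳ)
import Data.Vec.Properties as Vec
open import Data.List using (List; []; _∷_)
import Data.List as List
open import Data.List.Relation.Unary.All using (All; []; _∷_)
import Data.List.Relation.Unary.All as All
open import Data.List.Relation.Unary.All.Properties using (map⁺; map⁻)
open import Data.Product using (Σ; _×_; _,_; ∃; proj₁)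
open import Data.Product.Properties using (≡-dec)
import Data.Product as Product
open import Data.Sum using (_⊎_; inj₁; inj₂; [_,_])
import Data.Sum as Sum
open import Function using (_∘_; id)
open import Data.Empty using (⊥-elim)
open import Relation.Nullary using (¬_; yes; no; Dec)
open import Relation.Binary.PropositionalEquality
  using (_≡_; _≢_; refl; sym; trans; cong; cong₂; module ≡-Reasoning)
  renaming (subst to transport; subst₂ to transport₂)
open import Relation.Binary.Construct.Closure.ReflexiveTransitive using (Star; ε; _◅_; _◅◅_; gmap; return)

infix 4 _≐_
_≐_ : {A : Set} → (Sort → ℕ → A) → (Sort → ℕ → A) → Set
f ≐ g = ∀ s i → f s i ≡ g s i

Var : Set
Var = Sort × ℕ

_≟ᵥ_ : (x y : Var) → Dec (x ≡ y)
_≟ᵥ_ = ≡-dec _≟S_ ℕ._≟_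

update : {A : Set} → (Sort → ℕ → A) → Var → A → Sort → ℕ → A
update σ x a s i with (s , i) ≟ᵥ x
... | yes _ = a
... | no _ = σ s i

update-same : ∀ {A : Set} (σ : Sort → ℕ → A) s i a → update σ (s , i) a s i ≡ a
update-same σ s i a with (s , i) ≟ᵥ (s , i)
... | yes _ = refl
... | no s,i≢s,i = ⊥-elim (s,i≢s,i refl)

update-other : ∀ {A : Set} (σ : Sort → ℕ → A) {x} s i a → (s , i) ≢ x → update σ x a s i ≡ σ s i
update-other σ {x} s i a s,i≢x with (s , i) ≟ᵥ x
... | yes s,i≡x = ⊥-elim (s,i≢x s,i≡x)
... | no _ = refl

double : ℕ → ℕ
double zero = zero
double (suc n) = suc (suc (double n))

interleave : {A : Set} → (ℕ → A) → (ℕ → A) → ℕ → A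
interleave f g zero = f zero
interleave f g (suc n) = interleave g (f ∘ suc) n

interleave-double : ∀ {A : Set} (f g : ℕ → A) i → interleave f g (double i) ≡ f i
interleave-double f g zero = refl
interleave-double f g (suc i) = interleave-double (f ∘ suc) (g ∘ suc) i

interleave-suc-double : ∀ {A : Set} (f g : ℕ → A) i → interleave f g (suc (double i)) ≡ g i
interleave-suc-double f g = interleave-double g (f ∘ suc)

module _ {F : Set} {arity : F → ℕ} where
  open Terms F arity

  -- Renaming and substitution

  liftR-cong : ∀ b {ρ ρ'} → ρ ≐ ρ' → liftR b ρ ≐ liftR b ρ'
  liftR-cong ⋆ e ⋆ zero = refl
  liftR-cong ⋆ e ⋆ (suc i) = cong suc (e ⋆ i)
  liftR-cong ⋆ e □ i = e □ i
  liftR-cong □ e ⋆ i = e ⋆ i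
  liftR-cong □ e □ zero = refl
  liftR-cong □ e □ (suc i) = cong suc (e □ i)

  mutual
    rename-cong : ∀ {ρ ρ'} → ρ ≐ ρ' → ∀ t → rename ρ t ≡ rename ρ' t
    rename-cong e (sort s) = refl
    rename-cong e (var s i) = cong (var s) (e s i)
    rename-cong e (prod s t u) = cong₂ (prod s) (rename-cong e t) (rename-cong (liftR-cong s e) u)
    rename-cong e (abs s t u) = cong₂ (abs s) (rename-cong e t) (rename-cong (liftR-cong s e) u)
    rename-cong e (app t u) = cong₂ app (rename-cong e t) (rename-cong e u)
    rename-cong e (fun f ts) = cong (fun f) (renameV-cong e ts)

    renameV-cong : ∀ {n ρ ρ'} → ρ ≐ ρ' → (ts : Vec Term n) → renameV ρ ts ≡ renameV ρ' ts
    renameV-cong e [] = refl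
    renameV-cong e (t ∷ ts) = cong₂ _∷_ (rename-cong e t) (renameV-cong e ts)

  weaken-up : ∀ b t → weaken b t ≡ rename (up b) t
  weaken-up ⋆ = rename-cong λ { ⋆ i → refl ; □ i → refl }
  weaken-up □ = rename-cong λ { ⋆ i → refl ; □ i → refl }

  liftS-cong : ∀ b {σ σ'} → σ ≐ σ' → liftS b σ ≐ liftS b σ'
  liftS-cong ⋆ e ⋆ zero = refl
  liftS-cong ⋆ e ⋆ (suc i) = cong (weaken ⋆) (e ⋆ i)
  liftS-cong ⋆ e □ i = cong (weaken ⋆) (e □ i)
  liftS-cong □ e ⋆ i = cong (weaken □) (e ⋆ i)
  liftS-cong □ e □ zero = refl
  liftS-cong □ e □ (suc i) = cong (weaken □) (e □ i)

  mutual
    subst-cong : ∀ {σ σ'} → σ ≐ σ' → ∀ t → subst σ t ≡ subst σ' t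
    subst-cong e (sort s) = refl
    subst-cong e (var s i) = e s i
    subst-cong e (prod s t u) = cong₂ (prod s) (subst-cong e t) (subst-cong (liftS-cong s e) u)
    subst-cong e (abs s t u) = cong₂ (abs s) (subst-cong e t) (subst-cong (liftS-cong s e) u)
    subst-cong e (app t u) = cong₂ app (subst-cong e t) (subst-cong e u)
    subst-cong e (fun f ts) = cong (fun f) (substV-cong e ts)

    substV-cong : ∀ {n σ σ'} → σ ≐ σ' → (ts : Vec Term n) → substV σ ts ≡ substV σ' ts
    substV-cong e [] = refl
    substV-cong e (t ∷ ts) = cong₂ _∷_ (subst-cong e t) (substV-cong e ts)

  idS : Sub
  idS = var

  liftS-id : ∀ b → liftS b idS ≐ idS
  liftS-id ⋆ ⋆ zero = refl
  liftS-id ⋆ ⋆ (suc i) = refl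
  liftS-id ⋆ □ i = refl
  liftS-id □ ⋆ i = refl
  liftS-id □ □ zero = refl
  liftS-id □ □ (suc i) = refl

  mutual
    subst-id : ∀ t → subst idS t ≡ t
    subst-id (sort s) = refl
    subst-id (var s i) = refl
    subst-id (prod s t u) = cong₂ (prod s) (subst-id t) (trans (subst-cong (liftS-id s) u) (subst-id u))
    subst-id (abs s t u) = cong₂ (abs s) (subst-id t) (trans (subst-cong (liftS-id s) u) (subst-id u))
    subst-id (app t u) = cong₂ app (subst-id t) (subst-id u)
    subst-id (fun f ts) = cong (fun f) (substV-id ts)

    substV-id : ∀ {n} (ts : Vec Term n) → substV idS ts ≡ ts
    substV-id [] = refl
    substV-id (t ∷ ts) = cong₂ _∷_ (subst-id t) (substV-id ts)

  infixl 9 _ˢ∘ʳ_ _ʳ∘ˢ_ _∘ˢ_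

  _ˢ∘ʳ_ : Sub → Ren → Sub
  (σ ˢ∘ʳ ρ) s i = σ s (ρ s i)

  _ʳ∘ˢ_ : Ren → Sub → Sub
  (ρ ʳ∘ˢ σ) s i = rename ρ (σ s i)

  _∘ˢ_ : Sub → Sub → Sub
  (θ ∘ˢ σ) s i = subst θ (σ s i)

  liftS-liftR : ∀ b σ ρ → liftS b σ ˢ∘ʳ liftR b ρ ≐ liftS b (σ ˢ∘ʳ ρ)
  liftS-liftR ⋆ σ ρ ⋆ zero = refl
  liftS-liftR ⋆ σ ρ ⋆ (suc i) = refl
  liftS-liftR ⋆ σ ρ □ i = refl
  liftS-liftR □ σ ρ ⋆ i = refl
  liftS-liftR □ σ ρ □ zero = refl
  liftS-liftR □ σ ρ □ (suc i) = refl

  mutual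
    subst-rename : ∀ σ ρ t → subst σ (rename ρ t) ≡ subst (σ ˢ∘ʳ ρ) t
    subst-rename σ ρ (sort s) = refl
    subst-rename σ ρ (var s i) = refl
    subst-rename σ ρ (prod s t u) = cong₂ (prod s) (subst-rename σ ρ t)
      (trans (subst-rename (liftS s σ) (liftR s ρ) u) (subst-cong (liftS-liftR s σ ρ) u))
    subst-rename σ ρ (abs s t u) = cong₂ (abs s) (subst-rename σ ρ t)
      (trans (subst-rename (liftS s σ) (liftR s ρ) u) (subst-cong (liftS-liftR s σ ρ) u))
    subst-rename σ ρ (app t u) = cong₂ app (subst-rename σ ρ t) (subst-rename σ ρ u)
    subst-rename σ ρ (fun f ts) = cong (fun f) (substV-rename σ ρ ts)

    substV-rename : ∀ {n} σ ρ (ts : Vec Term n) → substV σ (renameV ρ ts) ≡ substV (σ ˢ∘ʳ ρ) ts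
    substV-rename σ ρ [] = refl
    substV-rename σ ρ (t ∷ ts) = cong₂ _∷_ (subst-rename σ ρ t) (substV-rename σ ρ ts)

  ren : Ren → Sub
  ren ρ s i = var s (ρ s i)

  rename-as-subst : ∀ ρ t → rename ρ t ≡ subst (ren ρ) t
  rename-as-subst ρ t = trans (sym (subst-id (rename ρ t))) (subst-rename idS ρ t)

  weaken-as-subst : ∀ b t → weaken b t ≡ subst (ren (up b)) t
  weaken-as-subst b t = trans (weaken-up b t) (rename-as-subst (up b) t)

  rename-rename : ∀ ρ ρ' t → rename ρ' (rename ρ t) ≡ rename (λ s → ρ' s ∘ ρ s) t
  rename-rename ρ ρ' t = begin
    rename ρ' (rename ρ t)        ≡⟨ rename-as-subst ρ' (rename ρ t) ⟩
    subst (ren ρ') (rename ρ t)   ≡⟨ subst-rename (ren ρ') ρ t ⟩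
    subst (ren ρ' ˢ∘ʳ ρ) t        ≡⟨ sym (rename-as-subst _ t) ⟩
    rename (λ s → ρ' s ∘ ρ s) t ∎
    where open ≡-Reasoning

  liftR-up : ∀ b ρ s i → liftR b ρ s (up b s i) ≡ up b s (ρ s i)
  liftR-up ⋆ ρ ⋆ i = refl
  liftR-up ⋆ ρ □ i = refl
  liftR-up □ ρ ⋆ i = refl
  liftR-up □ ρ □ i = refl

  rename-weaken : ∀ b ρ t → rename (liftR b ρ) (weaken b t) ≡ weaken b (rename ρ t)
  rename-weaken b ρ t = begin
    rename (liftR b ρ) (weaken b t)            ≡⟨ cong (rename (liftR b ρ)) (weaken-up b t) ⟩
    rename (liftR b ρ) (rename (up b) t)       ≡⟨ rename-rename (up b) (liftR b ρ) t ⟩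
    rename (λ s → liftR b ρ s ∘ up b s) t      ≡⟨ rename-cong (liftR-up b ρ) t ⟩
    rename (λ s → up b s ∘ ρ s) t              ≡⟨ sym (rename-rename ρ (up b) t) ⟩
    rename (up b) (rename ρ t)                 ≡⟨ sym (weaken-up b (rename ρ t)) ⟩
    weaken b (rename ρ t)                      ∎
    where open ≡-Reasoning

  liftR-liftS : ∀ b ρ σ → liftR b ρ ʳ∘ˢ liftS b σ ≐ liftS b (ρ ʳ∘ˢ σ)
  liftR-liftS ⋆ ρ σ ⋆ zero = refl
  liftR-liftS ⋆ ρ σ ⋆ (suc i) = rename-weaken ⋆ ρ (σ ⋆ i)
  liftR-liftS ⋆ ρ σ □ i = rename-weaken ⋆ ρ (σ □ i)
  liftR-liftS □ ρ σ ⋆ i = rename-weaken □ ρ (σ ⋆ i)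
  liftR-liftS □ ρ σ □ zero = refl
  liftR-liftS □ ρ σ □ (suc i) = rename-weaken □ ρ (σ □ i)

  mutual
    rename-subst : ∀ ρ σ t → rename ρ (subst σ t) ≡ subst (ρ ʳ∘ˢ σ) t
    rename-subst ρ σ (sort s) = refl
    rename-subst ρ σ (var s i) = refl
    rename-subst ρ σ (prod s t u) = cong₂ (prod s) (rename-subst ρ σ t)
      (trans (rename-subst (liftR s ρ) (liftS s σ) u) (subst-cong (liftR-liftS s ρ σ) u))
    rename-subst ρ σ (abs s t u) = cong₂ (abs s) (rename-subst ρ σ t)
      (trans (rename-subst (liftR s ρ) (liftS s σ) u) (subst-cong (liftR-liftS s ρ σ) u))
    rename-subst ρ σ (app t u) = cong₂ app (rename-subst ρ σ t) (rename-subst ρ σ u)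
    rename-subst ρ σ (fun f ts) = cong (fun f) (renameV-subst ρ σ ts)

    renameV-subst : ∀ {n} ρ σ (ts : Vec Term n) → renameV ρ (substV σ ts) ≡ substV (ρ ʳ∘ˢ σ) ts
    renameV-subst ρ σ [] = refl
    renameV-subst ρ σ (t ∷ ts) = cong₂ _∷_ (rename-subst ρ σ t) (renameV-subst ρ σ ts)

  liftS-up : ∀ b σ → liftS b σ ˢ∘ʳ up b ≐ up b ʳ∘ˢ σ
  liftS-up ⋆ σ ⋆ i = weaken-up ⋆ (σ ⋆ i)
  liftS-up ⋆ σ □ i = weaken-up ⋆ (σ □ i)
  liftS-up □ σ ⋆ i = weaken-up □ (σ ⋆ i)
  liftS-up □ σ □ i = weaken-up □ (σ □ i)

  subst-weaken : ∀ b σ t → subst (liftS b σ) (weaken b t) ≡ weaken b (subst σ t)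
  subst-weaken b σ t = begin
    subst (liftS b σ) (weaken b t)        ≡⟨ cong (subst (liftS b σ)) (weaken-up b t) ⟩
    subst (liftS b σ) (rename (up b) t)   ≡⟨ subst-rename (liftS b σ) (up b) t ⟩
    subst (liftS b σ ˢ∘ʳ up b) t          ≡⟨ subst-cong (liftS-up b σ) t ⟩
    subst (up b ʳ∘ˢ σ) t                  ≡⟨ sym (rename-subst (up b) σ t) ⟩
    rename (up b) (subst σ t)             ≡⟨ sym (weaken-up b (subst σ t)) ⟩
    weaken b (subst σ t)                  ∎
    where open ≡-Reasoning

  liftS-liftS : ∀ b θ σ → liftS b θ ∘ˢ liftS b σ ≐ liftS b (θ ∘ˢ σ)
  liftS-liftS ⋆ θ σ ⋆ zero = refl
  liftS-liftS ⋆ θ σ ⋆ (suc i) = subst-weaken ⋆ θ (σ ⋆ i)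
  liftS-liftS ⋆ θ σ □ i = subst-weaken ⋆ θ (σ □ i)
  liftS-liftS □ θ σ ⋆ i = subst-weaken □ θ (σ ⋆ i)
  liftS-liftS □ θ σ □ zero = refl
  liftS-liftS □ θ σ □ (suc i) = subst-weaken □ θ (σ □ i)

  mutual
    subst-subst : ∀ θ σ t → subst θ (subst σ t) ≡ subst (θ ∘ˢ σ) t
    subst-subst θ σ (sort s) = refl
    subst-subst θ σ (var s i) = refl
    subst-subst θ σ (prod s t u) = cong₂ (prod s) (subst-subst θ σ t)
      (trans (subst-subst (liftS s θ) (liftS s σ) u) (subst-cong (liftS-liftS s θ σ) u))
    subst-subst θ σ (abs s t u) = cong₂ (abs s) (subst-subst θ σ t)
      (trans (subst-subst (liftS s θ) (liftS s σ) u) (subst-cong (liftS-liftS s θ σ) u))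
    subst-subst θ σ (app t u) = cong₂ app (subst-subst θ σ t) (subst-subst θ σ u)
    subst-subst θ σ (fun f ts) = cong (fun f) (substV-subst θ σ ts)

    substV-subst : ∀ {n} θ σ (ts : Vec Term n) → substV θ (substV σ ts) ≡ substV (θ ∘ˢ σ) ts
    substV-subst θ σ [] = refl
    substV-subst θ σ (t ∷ ts) = cong₂ _∷_ (subst-subst θ σ t) (substV-subst θ σ ts)

  single-up : ∀ b u → single b u ˢ∘ʳ up b ≐ idS
  single-up ⋆ u ⋆ i = refl
  single-up ⋆ u □ i = refl
  single-up □ u ⋆ i = refl
  single-up □ u □ i = refl

  single-weaken : ∀ b u t → subst (single b u) (weaken b t) ≡ t
  single-weaken b u t = begin
    subst (single b u) (weaken b t)        ≡⟨ cong (subst (single b u)) (weaken-up b t) ⟩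
    subst (single b u) (rename (up b) t)   ≡⟨ subst-rename (single b u) (up b) t ⟩
    subst (single b u ˢ∘ʳ up b) t          ≡⟨ subst-cong (single-up b u) t ⟩
    subst idS t                            ≡⟨ subst-id t ⟩
    t                                      ∎
    where open ≡-Reasoning

  single-liftS : ∀ σ b u → σ ∘ˢ single b u ≐ single b (subst σ u) ∘ˢ liftS b σ
  single-liftS σ ⋆ u ⋆ zero = refl
  single-liftS σ ⋆ u ⋆ (suc i) = sym (single-weaken ⋆ (subst σ u) (σ ⋆ i))
  single-liftS σ ⋆ u □ i = sym (single-weaken ⋆ (subst σ u) (σ □ i))
  single-liftS σ □ u ⋆ i = sym (single-weaken □ (subst σ u) (σ ⋆ i))
  single-liftS σ □ u □ zero = refl
  single-liftS σ □ u □ (suc i) = sym (single-weaken □ (subst σ u) (σ □ i))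

  subst-single : ∀ σ b t u → subst σ (t [ b ≔ u ]) ≡ subst (liftS b σ) t [ b ≔ subst σ u ]
  subst-single σ b t u = begin
    subst σ (subst (single b u) t)                          ≡⟨ subst-subst σ (single b u) t ⟩
    subst (σ ∘ˢ single b u) t                               ≡⟨ subst-cong (single-liftS σ b u) t ⟩
    subst (single b (subst σ u) ∘ˢ liftS b σ) t             ≡⟨ sym (subst-subst (single b (subst σ u)) (liftS b σ) t) ⟩
    subst (single b (subst σ u)) (subst (liftS b σ) t)      ∎
    where open ≡-Reasoning

  lookup-substV : ∀ {n} σ (ts : Vec Term n) k → lookup (substV σ ts) k ≡ subst σ (lookup ts k)
  lookup-substV σ (t ∷ ts) zero = refl
  lookup-substV σ (t ∷ ts) (suc k) = lookup-substV σ ts k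

  substV-[]≔ : ∀ {n} σ (ts : Vec Term n) k u → substV σ (ts [ k ]≔ u) ≡ substV σ ts [ k ]≔ subst σ u
  substV-[]≔ σ (t ∷ ts) zero u = refl
  substV-[]≔ σ (t ∷ ts) (suc k) u = cong (subst σ t ∷_) (substV-[]≔ σ ts k u)

  -- Algebraic terms

  data Alg : Set where
    avar : Sort → ℕ → Alg
    afun : (f : F) → Vec Alg (arity f) → Alg

  AlgSub : Set
  AlgSub = Sort → ℕ → Alg

  infix 5 _↦_
  _↦_ : Var → Alg → AlgSub
  x ↦ b = update avar x b

  mutual
    ⌜_⌝ : Alg → Term
    ⌜ avar s i ⌝ = var s i
    ⌜ afun f as ⌝ = fun f ⌜ as ⌝V

    ⌜_⌝V : ∀ {n} → Vec Alg n → Vec Term n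
    ⌜ [] ⌝V = []
    ⌜ a ∷ as ⌝V = ⌜ a ⌝ ∷ ⌜ as ⌝V

  ⌜_⌝ˢ : AlgSub → Sub
  ⌜ μ ⌝ˢ s i = ⌜ μ s i ⌝

  mutual
    asubst : AlgSub → Alg → Alg
    asubst μ (avar s i) = μ s i
    asubst μ (afun f as) = afun f (asubstV μ as)

    asubstV : ∀ {n} → AlgSub → Vec Alg n → Vec Alg n
    asubstV μ [] = []
    asubstV μ (a ∷ as) = asubst μ a ∷ asubstV μ as

  mutual
    ⌜asubst⌝ : ∀ μ a → ⌜ asubst μ a ⌝ ≡ subst ⌜ μ ⌝ˢ ⌜ a ⌝
    ⌜asubst⌝ μ (avar s i) = refl
    ⌜asubst⌝ μ (afun f as) = cong (fun f) (⌜asubstV⌝ μ as)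

    ⌜asubstV⌝ : ∀ {n} μ (as : Vec Alg n) → ⌜ asubstV μ as ⌝V ≡ substV ⌜ μ ⌝ˢ ⌜ as ⌝V
    ⌜asubstV⌝ μ [] = refl
    ⌜asubstV⌝ μ (a ∷ as) = cong₂ _∷_ (⌜asubst⌝ μ a) (⌜asubstV⌝ μ as)

  subst-⌜asubst⌝ : ∀ θ μ a → subst θ ⌜ asubst μ a ⌝ ≡ subst (θ ∘ˢ ⌜ μ ⌝ˢ) ⌜ a ⌝
  subst-⌜asubst⌝ θ μ a = trans (cong (subst θ) (⌜asubst⌝ μ a)) (subst-subst θ ⌜ μ ⌝ˢ ⌜ a ⌝)

  infixl 9 _∘ᵃ_
  _∘ᵃ_ : AlgSub → AlgSub → AlgSub
  (ν ∘ᵃ μ) s i = asubst ν (μ s i)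

  mutual
    asubst-asubst : ∀ ν μ a → asubst ν (asubst μ a) ≡ asubst (ν ∘ᵃ μ) a
    asubst-asubst ν μ (avar s i) = refl
    asubst-asubst ν μ (afun f as) = cong (afun f) (asubstV-asubstV ν μ as)

    asubstV-asubstV : ∀ {n} ν μ (as : Vec Alg n) → asubstV ν (asubstV μ as) ≡ asubstV (ν ∘ᵃ μ) as
    asubstV-asubstV ν μ [] = refl
    asubstV-asubstV ν μ (a ∷ as) = cong₂ _∷_ (asubst-asubst ν μ a) (asubstV-asubstV ν μ as)

  mutual
    alg⇒Alg : ∀ {t} → Algebraic t → Σ Alg λ a → ⌜ a ⌝ ≡ t
    alg⇒Alg (var s i) = avar s i , refl
    alg⇒Alg (fun f ts ts-alg) with algV⇒Alg ts-alg
    ... | as , refl = afun f as , refl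

    algV⇒Alg : ∀ {n} {ts : Vec Term n} → AlgebraicV ts → Σ (Vec Alg n) λ as → ⌜ as ⌝V ≡ ts
    algV⇒Alg [] = [] , refl
    algV⇒Alg (t-alg ∷ ts-alg) with alg⇒Alg t-alg | algV⇒Alg ts-alg
    ... | a , refl | as , refl = a ∷ as , refl

  mutual
    ⌜⌝-algebraic : ∀ a → Algebraic ⌜ a ⌝
    ⌜⌝-algebraic (avar s i) = var s i
    ⌜⌝-algebraic (afun f as) = fun f ⌜ as ⌝V (⌜⌝V-algebraic as)

    ⌜⌝V-algebraic : ∀ {n} (as : Vec Alg n) → AlgebraicV ⌜ as ⌝V
    ⌜⌝V-algebraic [] = []
    ⌜⌝V-algebraic (a ∷ as) = ⌜⌝-algebraic a ∷ ⌜⌝V-algebraic as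

  lookup-⌜⌝V : ∀ {n} (as : Vec Alg n) k → lookup ⌜ as ⌝V k ≡ ⌜ lookup as k ⌝
  lookup-⌜⌝V (a ∷ as) zero = refl
  lookup-⌜⌝V (a ∷ as) (suc k) = lookup-⌜⌝V as k

  ⌜⌝V-[]≔ : ∀ {n} (as : Vec Alg n) k b → ⌜ as [ k ]≔ b ⌝V ≡ ⌜ as ⌝V [ k ]≔ ⌜ b ⌝
  ⌜⌝V-[]≔ (a ∷ as) zero b = refl
  ⌜⌝V-[]≔ (a ∷ as) (suc k) b = cong (⌜ a ⌝ ∷_) (⌜⌝V-[]≔ as k b)

  mutual
    data Occurs : Var → Alg → Set where
      here : ∀ {s i} → Occurs (s , i) (avar s i)
      there : ∀ {x f as} → OccursV x as → Occurs x (afun f as)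

    data OccursV (x : Var) : ∀ {n} → Vec Alg n → Set where
      head : ∀ {n a} {as : Vec Alg n} → Occurs x a → OccursV x (a ∷ as)
      tail : ∀ {n a} {as : Vec Alg n} → OccursV x as → OccursV x (a ∷ as)

  mutual
    occurs? : ∀ x a → Dec (Occurs x a)
    occurs? x (avar s i) with x ≟ᵥ (s , i)
    ... | yes refl = yes here
    ... | no x≢s,i = no λ { here → x≢s,i refl }
    occurs? x (afun f as) with occursV? x as
    ... | yes x∈as = yes (there x∈as)
    ... | no x∉as = no λ { (there x∈as) → x∉as x∈as }

    occursV? : ∀ {n} x (as : Vec Alg n) → Dec (OccursV x as)
    occursV? x [] = no λ ()
    occursV? x (a ∷ as) with occurs? x a | occursV? x as
    ... | yes x∈a | _ = yes (head x∈a)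
    ... | no _ | yes x∈as = yes (tail x∈as)
    ... | no x∉a | no x∉as = no λ { (head x∈a) → x∉a x∈a ; (tail x∈as) → x∉as x∈as }

  mutual
    asubst-fresh : ∀ {x b} a → ¬ Occurs x a → asubst (x ↦ b) a ≡ a
    asubst-fresh (avar s i) x∉a = update-other avar s i _ λ { refl → x∉a here }
    asubst-fresh (afun f as) x∉a = cong (afun f) (asubstV-fresh as λ x∈as → x∉a (there x∈as))

    asubstV-fresh : ∀ {x b n} (as : Vec Alg n) → ¬ OccursV x as → asubstV (x ↦ b) as ≡ as
    asubstV-fresh [] _ = refl
    asubstV-fresh (a ∷ as) x∉a∷as =
      cong₂ _∷_ (asubst-fresh a λ x∈a → x∉a∷as (head x∈a)) (asubstV-fresh as λ x∈as → x∉a∷as (tail x∈as))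

  -- Unification guided by a known solution

  mutual
    size : Term → ℕ
    size (sort s) = 1
    size (var s i) = 1
    size (prod s t u) = suc (size t + size u)
    size (abs s t u) = suc (size t + size u)
    size (app t u) = suc (size t + size u)
    size (fun f ts) = suc (sizeV ts)

    sizeV : ∀ {n} → Vec Term n → ℕ
    sizeV [] = 0
    sizeV (t ∷ ts) = size t + sizeV ts

  size-pos : ∀ t → 0 < size t
  size-pos (sort s) = s≤s z≤n
  size-pos (var s i) = s≤s z≤n
  size-pos (prod s t u) = s≤s z≤n
  size-pos (abs s t u) = s≤s z≤n
  size-pos (app t u) = s≤s z≤n
  size-pos (fun f ts) = s≤s z≤n

  mutual
    size-occurs : ∀ θ {s i} a → Occurs (s , i) a → size (θ s i) ≤ size (subst θ ⌜ a ⌝)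
    size-occurs θ (avar s i) here = ≤-refl
    size-occurs θ (afun f as) (there x∈as) = m≤n⇒m≤1+n (sizeV-occurs θ as x∈as)

    sizeV-occurs : ∀ θ {s i n} (as : Vec Alg n) → OccursV (s , i) as → size (θ s i) ≤ sizeV (substV θ ⌜ as ⌝V)
    sizeV-occurs θ (a ∷ as) (head x∈a) = ≤-trans (size-occurs θ a x∈a) (m≤m+n _ _)
    sizeV-occurs θ (a ∷ as) (tail x∈as) = ≤-trans (sizeV-occurs θ as x∈as) (m≤n+m _ _)

  occurs-check : ∀ θ {s i} b → θ s i ≡ subst θ ⌜ b ⌝ → b ≡ avar s i ⊎ ¬ Occurs (s , i) b
  occurs-check θ {s} {i} b θx≡θb with occurs? (s , i) b
  ... | yes here = inj₁ refl
  ... | yes (there {as = as} x∈as) =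
    ⊥-elim (<-irrefl refl (transport (λ t → size t ≤ sizeV (substV θ ⌜ as ⌝V)) θx≡θb (sizeV-occurs θ as x∈as)))
  ... | no x∉b = inj₂ x∉b

  fun-injective : ∀ {f g xs ys} → _≡_ {A = Term} (fun f xs) (fun g ys) → Σ (f ≡ g) λ { refl → xs ≡ ys }
  fun-injective refl = refl , refl

  Eqn : Set
  Eqn = Alg × Alg

  _Unifies_ : AlgSub → List Eqn → Set
  ν Unifies E = All (λ (a , b) → asubst ν a ≡ asubst ν b) E

  zipEqns : ∀ {n} → Vec Alg n → Vec Alg n → List Eqn → List Eqn
  zipEqns [] [] E = E
  zipEqns (a ∷ as) (b ∷ bs) E = (a , b) ∷ zipEqns as bs E

  mapEqns : AlgSub → List Eqn → List Eqn
  mapEqns μ = List.map (Product.map (asubst μ) (asubst μ))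

  module Unification (θ : Sub) where

    Solves : List Eqn → Set
    Solves E = All (λ (a , b) → subst θ ⌜ a ⌝ ≡ subst θ ⌜ b ⌝) E

    record Unifier (E : List Eqn) : Set where
      field
        ν : AlgSub
        unifies : ν Unifies E
        θ' : Sub
        factors : θ' ∘ˢ ⌜ ν ⌝ˢ ≐ θ

    -- θ remains a solution, so unification cannot fail; decomposition and variable elimination
    -- both decrease the total size of the θ-instances of the left-hand sides.
    weight : List Eqn → ℕ
    weight [] = 0
    weight ((a , _) ∷ E) = size (subst θ ⌜ a ⌝) + weight E

    weight-tail< : ∀ a b E → weight E < weight ((a , b) ∷ E)
    weight-tail< a b E = m<n+m (weight E) (size-pos (subst θ ⌜ a ⌝))

    weight-zipEqns : ∀ {n} (as bs : Vec Alg n) E → weight (zipEqns as bs E) ≡ sizeV (substV θ ⌜ as ⌝V) + weight E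
    weight-zipEqns [] [] E = refl
    weight-zipEqns (a ∷ as) (b ∷ bs) E =
      trans (cong (size (subst θ ⌜ a ⌝) +_) (weight-zipEqns as bs E)) (sym (+-assoc (size (subst θ ⌜ a ⌝)) _ _))

    weight-zipEqns< : ∀ {f} (as bs : Vec Alg (arity f)) b E → weight (zipEqns as bs E) < weight ((afun f as , b) ∷ E)
    weight-zipEqns< as bs b E = ≤-reflexive (cong suc (weight-zipEqns as bs E))

    solves-zipEqns : ∀ {n} (as bs : Vec Alg n) {E} →
      substV θ ⌜ as ⌝V ≡ substV θ ⌜ bs ⌝V → Solves E → Solves (zipEqns as bs E)
    solves-zipEqns [] [] _ sol = sol
    solves-zipEqns (a ∷ as) (b ∷ bs) eq sol = ∷-injectiveˡ eq ∷ solves-zipEqns as bs (∷-injectiveʳ eq) sol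

    unifies-unzip : ∀ {ν n} (as bs : Vec Alg n) {E} → ν Unifies zipEqns as bs E → asubstV ν as ≡ asubstV ν bs × ν Unifies E
    unifies-unzip [] [] un = refl , un
    unifies-unzip (a ∷ as) (b ∷ bs) (eq ∷ un) = Product.map₁ (cong₂ _∷_ eq) (unifies-unzip as bs un)

    module _ {s i b} (θx≡θb : θ s i ≡ subst θ ⌜ b ⌝) where

      update-solution : θ ∘ˢ ⌜ (s , i) ↦ b ⌝ˢ ≐ θ
      update-solution s' i' with (s' , i') ≟ᵥ (s , i)
      ... | yes refl = sym θx≡θb
      ... | no _ = refl

      subst-update : ∀ a → subst θ ⌜ asubst ((s , i) ↦ b) a ⌝ ≡ subst θ ⌜ a ⌝
      subst-update a = trans (subst-⌜asubst⌝ θ _ a) (subst-cong update-solution ⌜ a ⌝)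

      solves-mapEqns : ∀ {E} → Solves E → Solves (mapEqns ((s , i) ↦ b) E)
      solves-mapEqns sol = map⁺ (All.map (λ {(a , c)} eq → trans (subst-update a) (trans eq (sym (subst-update c)))) sol)

      weight-mapEqns : ∀ E → weight (mapEqns ((s , i) ↦ b) E) ≡ weight E
      weight-mapEqns [] = refl
      weight-mapEqns ((a , _) ∷ E) = cong₂ _+_ (cong size (subst-update a)) (weight-mapEqns E)

      weight-mapEqns< : ∀ a c E → weight (mapEqns ((s , i) ↦ b) E) < weight ((a , c) ∷ E)
      weight-mapEqns< a c E = transport (_< weight ((a , c) ∷ E)) (sym (weight-mapEqns E)) (weight-tail< a c E)

    unifier-[] : Unifier []
    unifier-[] = record { ν = avar ; unifies = [] ; θ' = θ ; factors = λ _ _ → refl }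

    unifier-refl : ∀ {s i E} → Unifier E → Unifier ((avar s i , avar s i) ∷ E)
    unifier-refl U = record { ν = ν ; unifies = refl ∷ unifies ; θ' = θ' ; factors = factors }
      where open Unifier U

    unifier-sym : ∀ {a b E} → Unifier ((a , b) ∷ E) → Unifier ((b , a) ∷ E)
    unifier-sym U with Unifier.unifies U
    ... | eq ∷ un = record { ν = ν ; unifies = sym eq ∷ un ; θ' = θ' ; factors = factors }
      where open Unifier U

    unifier-decompose : ∀ {f} (as bs : Vec Alg (arity f)) {E} → Unifier (zipEqns as bs E) → Unifier ((afun f as , afun f bs) ∷ E)
    unifier-decompose as bs U with unifies-unzip as bs (Unifier.unifies U)
    ... | eq , un = record { ν = ν ; unifies = cong (afun _) eq ∷ un ; θ' = θ' ; factors = factors }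
      where open Unifier U

    unifier-eliminate : ∀ {s i b E} → ¬ Occurs (s , i) b → θ s i ≡ subst θ ⌜ b ⌝ →
      Unifier (mapEqns ((s , i) ↦ b) E) → Unifier ((avar s i , b) ∷ E)
    unifier-eliminate {s} {i} {b} x∉b θx≡θb U = record
      { ν = ν ∘ᵃ ρ
      ; unifies = binds ∷ All.map (λ {(a , c)} eq → trans (sym (asubst-asubst ν ρ a)) (trans eq (asubst-asubst ν ρ c)))
                                  (map⁻ unifies)
      ; θ' = θ'
      ; factors = factors′
      }
      where
        open Unifier U
        open ≡-Reasoning
        ρ = (s , i) ↦ b
        binds : asubst ν (ρ s i) ≡ asubst (ν ∘ᵃ ρ) b
        binds = begin
          asubst ν (ρ s i)        ≡⟨ cong (asubst ν) (update-same avar s i b) ⟩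
          asubst ν b              ≡⟨ cong (asubst ν) (sym (asubst-fresh b x∉b)) ⟩
          asubst ν (asubst ρ b)   ≡⟨ asubst-asubst ν ρ b ⟩
          asubst (ν ∘ᵃ ρ) b       ∎
        factors′ : θ' ∘ˢ ⌜ ν ∘ᵃ ρ ⌝ˢ ≐ θ
        factors′ s' i' = begin
          subst θ' ⌜ asubst ν (ρ s' i') ⌝    ≡⟨ subst-⌜asubst⌝ θ' ν (ρ s' i') ⟩
          subst (θ' ∘ˢ ⌜ ν ⌝ˢ) ⌜ ρ s' i' ⌝   ≡⟨ subst-cong factors ⌜ ρ s' i' ⌝ ⟩
          subst θ ⌜ ρ s' i' ⌝                ≡⟨ update-solution θx≡θb s' i' ⟩
          θ s' i'                            ∎

    unify-acc : ∀ E → Solves E → Acc _<_ (weight E) → Unifier E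
    unify-acc [] [] _ = unifier-[]
    unify-acc ((afun f as , afun g bs) ∷ E) (eq ∷ sol) (acc rec) with fun-injective eq
    ... | refl , θas≡θbs = unifier-decompose as bs
      (unify-acc _ (solves-zipEqns as bs θas≡θbs sol) (rec (weight-zipEqns< as bs (afun f bs) E)))
    unify-acc ((avar s i , b) ∷ E) (eq ∷ sol) (acc rec) with occurs-check θ b eq
    ... | inj₁ refl = unifier-refl (unify-acc E sol (rec (weight-tail< (avar s i) (avar s i) E)))
    ... | inj₂ x∉b = unifier-eliminate x∉b eq
      (unify-acc _ (solves-mapEqns eq sol) (rec (weight-mapEqns< eq (avar s i) b E)))
    unify-acc ((afun f as , avar s i) ∷ E) (eq ∷ sol) (acc rec) with occurs-check θ (afun f as) (sym eq)
    ... | inj₂ x∉b = unifier-sym (unifier-eliminate x∉b (sym eq)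
      (unify-acc _ (solves-mapEqns (sym eq) sol) (rec (weight-mapEqns< (sym eq) (afun f as) (avar s i) E))))

  unify : ∀ θ E → Unification.Solves θ E → Unification.Unifier θ E
  unify θ E sol = Unification.unify-acc θ E sol (<-wellFounded _)

  record CommonAlgInstance (σ : Sub) (a : Alg) (σ' : Sub) (a' : Alg) : Set where
    field
      μ μ' : AlgSub
      θ : Sub
      unifies : asubst μ a ≡ asubst μ' a'
      factorsˡ : θ ∘ˢ ⌜ μ ⌝ˢ ≐ σ
      factorsʳ : θ ∘ˢ ⌜ μ' ⌝ˢ ≐ σ'

  -- a and a' are renamed apart to even and odd variables, and σ, σ' are merged accordingly.
  common-alg-instance : ∀ σ a σ' a' → subst σ ⌜ a ⌝ ≡ subst σ' ⌜ a' ⌝ → CommonAlgInstance σ a σ' a'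
  common-alg-instance σ a σ' a' σa≡σ'a' = record
    { μ = ν ∘ᵃ evens
    ; μ' = ν ∘ᵃ odds
    ; θ = θ'
    ; unifies = begin
        asubst (ν ∘ᵃ evens) a       ≡⟨ sym (asubst-asubst ν evens a) ⟩
        asubst ν (asubst evens a)   ≡⟨ All.head unifies ⟩
        asubst ν (asubst odds a')   ≡⟨ asubst-asubst ν odds a' ⟩
        asubst (ν ∘ᵃ odds) a'       ∎
    ; factorsˡ = λ s i → trans (factors s (double i)) (interleave-double (σ s) (σ' s) i)
    ; factorsʳ = λ s i → trans (factors s (suc (double i))) (interleave-suc-double (σ s) (σ' s) i)
    }
    where
      open ≡-Reasoning
      evens odds : AlgSub
      evens s i = avar s (double i)
      odds s i = avar s (suc (double i))
      σ⊕σ' : Sub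
      σ⊕σ' s = interleave (σ s) (σ' s)
      solves : subst σ⊕σ' ⌜ asubst evens a ⌝ ≡ subst σ⊕σ' ⌜ asubst odds a' ⌝
      solves = begin
        subst σ⊕σ' ⌜ asubst evens a ⌝   ≡⟨ subst-⌜asubst⌝ σ⊕σ' evens a ⟩
        subst (σ⊕σ' ∘ˢ ⌜ evens ⌝ˢ) ⌜ a ⌝  ≡⟨ subst-cong (λ s → interleave-double (σ s) (σ' s)) ⌜ a ⌝ ⟩
        subst σ ⌜ a ⌝                    ≡⟨ σa≡σ'a' ⟩
        subst σ' ⌜ a' ⌝                  ≡⟨ sym (subst-cong (λ s → interleave-suc-double (σ s) (σ' s)) ⌜ a' ⌝) ⟩
        subst (σ⊕σ' ∘ˢ ⌜ odds ⌝ˢ) ⌜ a' ⌝ ≡⟨ sym (subst-⌜asubst⌝ σ⊕σ' odds a') ⟩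
        subst σ⊕σ' ⌜ asubst odds a' ⌝   ∎
      open Unification.Unifier (unify σ⊕σ' ((asubst evens a , asubst odds a') ∷ []) (solves ∷ []))

  data AlgCtx : Set where
    hole : AlgCtx
    node : (f : F) → Vec Alg (arity f) → Fin (arity f) → AlgCtx → AlgCtx

  aplug : AlgCtx → Alg → Alg
  aplug hole a = a
  aplug (node f as k C) a = afun f (as [ k ]≔ aplug C a)

  -- C ⟨ σ ∣ t ⟩ is the instance of C by σ with t, left uninstantiated, in its hole.
  _⟨_∣_⟩ : AlgCtx → Sub → Term → Term
  hole ⟨ σ ∣ t ⟩ = t
  node f as k C ⟨ σ ∣ t ⟩ = fun f (substV σ ⌜ as ⌝V [ k ]≔ C ⟨ σ ∣ t ⟩)

  subst-aplug : ∀ σ C a → subst σ ⌜ aplug C a ⌝ ≡ C ⟨ σ ∣ subst σ ⌜ a ⌝ ⟩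
  subst-aplug σ hole a = refl
  subst-aplug σ (node f as k C) a = cong (fun f) (begin
    substV σ ⌜ as [ k ]≔ aplug C a ⌝V                 ≡⟨ cong (substV σ) (⌜⌝V-[]≔ as k (aplug C a)) ⟩
    substV σ (⌜ as ⌝V [ k ]≔ ⌜ aplug C a ⌝)           ≡⟨ substV-[]≔ σ ⌜ as ⌝V k ⌜ aplug C a ⌝ ⟩
    substV σ ⌜ as ⌝V [ k ]≔ subst σ ⌜ aplug C a ⌝     ≡⟨ cong (substV σ ⌜ as ⌝V [ k ]≔_) (subst-aplug σ C a) ⟩
    substV σ ⌜ as ⌝V [ k ]≔ C ⟨ σ ∣ subst σ ⌜ a ⌝ ⟩   ∎)
    where open ≡-Reasoning

  subst-plug : ∀ θ σ C t → subst θ (C ⟨ σ ∣ t ⟩) ≡ C ⟨ θ ∘ˢ σ ∣ subst θ t ⟩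
  subst-plug θ σ hole t = refl
  subst-plug θ σ (node f as k C) t = cong (fun f) (begin
    substV θ (substV σ ⌜ as ⌝V [ k ]≔ C ⟨ σ ∣ t ⟩)          ≡⟨ substV-[]≔ θ (substV σ ⌜ as ⌝V) k _ ⟩
    substV θ (substV σ ⌜ as ⌝V) [ k ]≔ subst θ (C ⟨ σ ∣ t ⟩) ≡⟨ cong₂ (_[ k ]≔_) (substV-subst θ σ ⌜ as ⌝V) (subst-plug θ σ C t) ⟩
    substV (θ ∘ˢ σ) ⌜ as ⌝V [ k ]≔ C ⟨ θ ∘ˢ σ ∣ subst θ t ⟩  ∎)
    where open ≡-Reasoning

  plug-cong : ∀ {σ σ'} → σ ≐ σ' → ∀ C t → C ⟨ σ ∣ t ⟩ ≡ C ⟨ σ' ∣ t ⟩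
  plug-cong σ≐σ' hole t = refl
  plug-cong σ≐σ' (node f as k C) t = cong (fun f) (cong₂ (_[ k ]≔_) (substV-cong σ≐σ' ⌜ as ⌝V) (plug-cong σ≐σ' C t))

  closure-plug : ∀ {B} C σ {t u} → Closure B t u → Closure B (C ⟨ σ ∣ t ⟩) (C ⟨ σ ∣ u ⟩)
  closure-plug hole σ t→u = t→u
  closure-plug (node f as k C) σ {t} t→u =
    transport (Closure _ _) (cong (fun f) (Vec.[]≔-idempotent ts k))
      (fun k (transport (λ x → Closure _ x _) (sym (Vec.lookup∘update k ts (C ⟨ σ ∣ t ⟩))) (closure-plug C σ t→u)))
    where ts = substV σ ⌜ as ⌝V

  -- Reduction as root steps in context

  module _ (R : Term → Term → Set) where

    data RootStep : Term → Term → Set where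
      rule : ∀ {t u l r} σ → R l r → t ≡ subst σ l → u ≡ subst σ r → RootStep t u
      beta : ∀ b U t u → RootStep (app (abs b U t) u) (t [ b ≔ u ])

    infix 4 _↝_ _↝*_ _⇉*_

    data _↝_ : Term → Term → Set where
      root  : ∀ {t u} → RootStep t u → t ↝ u
      prodˡ : ∀ {s t t' u} → t ↝ t' → prod s t u ↝ prod s t' u
      prodʳ : ∀ {s t u u'} → u ↝ u' → prod s t u ↝ prod s t u'
      absˡ  : ∀ {s t t' u} → t ↝ t' → abs s t u ↝ abs s t' u
      absʳ  : ∀ {s t u u'} → u ↝ u' → abs s t u ↝ abs s t u'
      appˡ  : ∀ {t t' u} → t ↝ t' → app t u ↝ app t' u
      appʳ  : ∀ {t u u'} → u ↝ u' → app t u ↝ app t u'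
      fun   : ∀ {f ts u} (k : Fin (arity f)) → lookup ts k ↝ u → fun f ts ↝ fun f (ts [ k ]≔ u)

    _↝*_ : Term → Term → Set
    _↝*_ = Star _↝_

    ↝-fun-lookup : ∀ {f} {ts : Vec Term (arity f)} k {a b} → lookup ts k ≡ a → a ↝ b → fun f ts ↝ fun f (ts [ k ]≔ b)
    ↝-fun-lookup k refl a↝b = fun k a↝b

    ↝-fun[]≔ : ∀ {f} (ts : Vec Term (arity f)) k {a b} → a ↝ b → fun f (ts [ k ]≔ a) ↝ fun f (ts [ k ]≔ b)
    ↝-fun[]≔ {f} ts k {a} a↝b =
      transport (fun f (ts [ k ]≔ a) ↝_) (cong (fun f) (Vec.[]≔-idempotent ts k))
        (↝-fun-lookup k (Vec.lookup∘update k ts a) a↝b)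

    ↝*-fun[]≔ : ∀ {f} (ts : Vec Term (arity f)) k {a b} → a ↝* b → fun f (ts [ k ]≔ a) ↝* fun f (ts [ k ]≔ b)
    ↝*-fun[]≔ ts k = gmap _ (↝-fun[]≔ ts k)

    ↝*-fun-lookup : ∀ {f} (ts : Vec Term (arity f)) k {b} → lookup ts k ↝* b → fun f ts ↝* fun f (ts [ k ]≔ b)
    ↝*-fun-lookup {f} ts k {b} = transport (_↝* fun f (ts [ k ]≔ b)) (cong (fun f) (Vec.[]≔-lookup ts k)) ∘ ↝*-fun[]≔ ts k

    ↝*-pointwise : ∀ {n} (Q : Vec Term n → Term) →
      (∀ vs k {u} → lookup vs k ↝* u → Q vs ↝* Q (vs [ k ]≔ u)) →
      ∀ xs ys → (∀ k → lookup xs k ↝* lookup ys k) → Q xs ↝* Q ys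
    ↝*-pointwise Q Q-step [] [] xs↝*ys = ε
    ↝*-pointwise Q Q-step (x ∷ xs) (y ∷ ys) xs↝*ys =
      Q-step (x ∷ xs) zero (xs↝*ys zero) ◅◅
      ↝*-pointwise (λ vs → Q (y ∷ vs)) (λ vs k → Q-step (y ∷ vs) (suc k)) xs ys (xs↝*ys ∘ suc)

    ↝*-fun-pointwise : ∀ {f} (xs ys : Vec Term (arity f)) → (∀ k → lookup xs k ↝* lookup ys k) → fun f xs ↝* fun f ys
    ↝*-fun-pointwise = ↝*-pointwise (fun _) ↝*-fun-lookup

    ↝*-fun-pointwise-[]≔ : ∀ {f} (xs ys : Vec Term (arity f)) k {u} →
      (∀ j → lookup xs j ↝* lookup ys j) → u ↝* lookup ys k → fun f (xs [ k ]≔ u) ↝* fun f ys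
    ↝*-fun-pointwise-[]≔ xs ys k {u} xs↝*ys u↝*ys[k] = ↝*-fun-pointwise (xs [ k ]≔ u) ys pointwise
      where
        pointwise : ∀ j → lookup (xs [ k ]≔ u) j ↝* lookup ys j
        pointwise j with j Fin.≟ k
        ... | yes refl = transport (_↝* _) (sym (Vec.lookup∘update k xs u)) u↝*ys[k]
        ... | no j≢k = transport (_↝* _) (sym (Vec.lookup∘update′ j≢k xs u)) (xs↝*ys j)

    root-subst : ∀ θ {t u} → RootStep t u → RootStep (subst θ t) (subst θ u)
    root-subst θ (rule {l = l} {r} σ l→r refl refl) = rule (θ ∘ˢ σ) l→r (subst-subst θ σ l) (subst-subst θ σ r)
    root-subst θ (beta b U t u) =
      transport (RootStep _) (sym (subst-single θ b t u)) (beta b (subst θ U) (subst (liftS b θ) t) (subst θ u))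

    ↝-subst : ∀ θ {t u} → t ↝ u → subst θ t ↝ subst θ u
    ↝-subst θ (root t→u) = root (root-subst θ t→u)
    ↝-subst θ (prodˡ t↝t') = prodˡ (↝-subst θ t↝t')
    ↝-subst θ (prodʳ {s} u↝u') = prodʳ (↝-subst (liftS s θ) u↝u')
    ↝-subst θ (absˡ t↝t') = absˡ (↝-subst θ t↝t')
    ↝-subst θ (absʳ {s} u↝u') = absʳ (↝-subst (liftS s θ) u↝u')
    ↝-subst θ (appˡ t↝t') = appˡ (↝-subst θ t↝t')
    ↝-subst θ (appʳ u↝u') = appʳ (↝-subst θ u↝u')
    ↝-subst θ (fun {f} {ts} {u} k ts[k]↝u) =
      transport (fun f (substV θ ts) ↝_) (cong (fun f) (sym (substV-[]≔ θ ts k u)))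
        (↝-fun-lookup k (lookup-substV θ ts k) (↝-subst θ ts[k]↝u))

    ↝*-subst : ∀ θ {t u} → t ↝* u → subst θ t ↝* subst θ u
    ↝*-subst θ = gmap (subst θ) (↝-subst θ)

    _⇉*_ : Sub → Sub → Set
    σ ⇉* σ' = ∀ s i → σ s i ↝* σ' s i

    ↝*-weaken : ∀ b {t u} → t ↝* u → weaken b t ↝* weaken b u
    ↝*-weaken b {t} {u} t↝*u =
      transport₂ _↝*_ (sym (weaken-as-subst b t)) (sym (weaken-as-subst b u)) (↝*-subst (ren (up b)) t↝*u)

    liftS-⇉* : ∀ b {σ σ'} → σ ⇉* σ' → liftS b σ ⇉* liftS b σ'
    liftS-⇉* ⋆ σ⇉*σ' ⋆ zero = ε
    liftS-⇉* ⋆ σ⇉*σ' ⋆ (suc i) = ↝*-weaken ⋆ (σ⇉*σ' ⋆ i)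
    liftS-⇉* ⋆ σ⇉*σ' □ i = ↝*-weaken ⋆ (σ⇉*σ' □ i)
    liftS-⇉* □ σ⇉*σ' ⋆ i = ↝*-weaken □ (σ⇉*σ' ⋆ i)
    liftS-⇉* □ σ⇉*σ' □ zero = ε
    liftS-⇉* □ σ⇉*σ' □ (suc i) = ↝*-weaken □ (σ⇉*σ' □ i)

    mutual
      ⇉*-subst : ∀ {σ σ'} → σ ⇉* σ' → ∀ t → subst σ t ↝* subst σ' t
      ⇉*-subst σ⇉*σ' (sort s) = ε
      ⇉*-subst σ⇉*σ' (var s i) = σ⇉*σ' s i
      ⇉*-subst σ⇉*σ' (prod s t u) = gmap _ prodˡ (⇉*-subst σ⇉*σ' t) ◅◅ gmap _ prodʳ (⇉*-subst (liftS-⇉* s σ⇉*σ') u)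
      ⇉*-subst σ⇉*σ' (abs s t u) = gmap _ absˡ (⇉*-subst σ⇉*σ' t) ◅◅ gmap _ absʳ (⇉*-subst (liftS-⇉* s σ⇉*σ') u)
      ⇉*-subst σ⇉*σ' (app t u) = gmap _ appˡ (⇉*-subst σ⇉*σ' t) ◅◅ gmap _ appʳ (⇉*-subst σ⇉*σ' u)
      ⇉*-subst {σ} {σ'} σ⇉*σ' (fun f ts) = ↝*-fun-pointwise (substV σ ts) (substV σ' ts) (⇉*-substV σ⇉*σ' ts)

      ⇉*-substV : ∀ {n σ σ'} → σ ⇉* σ' → (ts : Vec Term n) → ∀ k → lookup (substV σ ts) k ↝* lookup (substV σ' ts) k
      ⇉*-substV σ⇉*σ' (t ∷ ts) zero = ⇉*-subst σ⇉*σ' t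
      ⇉*-substV σ⇉*σ' (t ∷ ts) (suc k) = ⇉*-substV σ⇉*σ' ts k

    closure⇒↝ : ∀ {B} → (∀ {t u} → B t u → RootStep t u) → ∀ {t u} → Closure B t u → t ↝ u
    closure⇒↝ B⇒root (base t→u) = root (B⇒root t→u)
    closure⇒↝ B⇒root (subst⟨ σ ⟩ t→u) = ↝-subst σ (closure⇒↝ B⇒root t→u)
    closure⇒↝ B⇒root (prodˡ t→t') = prodˡ (closure⇒↝ B⇒root t→t')
    closure⇒↝ B⇒root (prodʳ u→u') = prodʳ (closure⇒↝ B⇒root u→u')
    closure⇒↝ B⇒root (absˡ t→t') = absˡ (closure⇒↝ B⇒root t→t')
    closure⇒↝ B⇒root (absʳ u→u') = absʳ (closure⇒↝ B⇒root u→u')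
    closure⇒↝ B⇒root (appˡ t→t') = appˡ (closure⇒↝ B⇒root t→t')
    closure⇒↝ B⇒root (appʳ u→u') = appʳ (closure⇒↝ B⇒root u→u')
    closure⇒↝ B⇒root (fun k ts[k]→u) = fun k (closure⇒↝ B⇒root ts[k]→u)

    rule⇒root : ∀ {l r} → R l r → RootStep l r
    rule⇒root {l} {r} l→r = rule idS l→r (sym (subst-id l)) (sym (subst-id r))

    beta⇒root : ∀ {t u} → BetaRoot t u → RootStep t u
    beta⇒root (beta b U t u) = beta b U t u

    ⟶⇒↝ : ∀ {t u} → t ⟶[ R ]∪β u → t ↝ u
    ⟶⇒↝ = [ closure⇒↝ rule⇒root , closure⇒↝ beta⇒root ]

    ↝⇒⟶ : ∀ {t u} → t ↝ u → t ⟶[ R ]∪β u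
    ↝⇒⟶ (root (rule σ l→r refl refl)) = inj₁ (subst⟨ σ ⟩ (base l→r))
    ↝⇒⟶ (root (beta b U t u)) = inj₂ (base (beta b U t u))
    ↝⇒⟶ (prodˡ t↝t') = Sum.map prodˡ prodˡ (↝⇒⟶ t↝t')
    ↝⇒⟶ (prodʳ u↝u') = Sum.map prodʳ prodʳ (↝⇒⟶ u↝u')
    ↝⇒⟶ (absˡ t↝t') = Sum.map absˡ absˡ (↝⇒⟶ t↝t')
    ↝⇒⟶ (absʳ u↝u') = Sum.map absʳ absʳ (↝⇒⟶ u↝u')
    ↝⇒⟶ (appˡ t↝t') = Sum.map appˡ appˡ (↝⇒⟶ t↝t')
    ↝⇒⟶ (appʳ u↝u') = Sum.map appʳ appʳ (↝⇒⟶ u↝u')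
    ↝⇒⟶ (fun k ts[k]↝u) = Sum.map (fun k) (fun k) (↝⇒⟶ ts[k]↝u)

    ↝*⇒⟶* : ∀ {t u} → t ↝* u → Star _⟶[ R ]∪β_ t u
    ↝*⇒⟶* = gmap id ↝⇒⟶

    Joinable : Term → Term → Set
    Joinable u v = ∃ λ w → u ↝* w × v ↝* w

    joinable-sym : ∀ {u v} → Joinable u v → Joinable v u
    joinable-sym (w , u↝*w , v↝*w) = w , v↝*w , u↝*w

    joinable-map : ∀ (f : Term → Term) → (∀ {a b} → a ↝ b → f a ↝ f b) →
      ∀ {u v} → Joinable u v → Joinable (f u) (f v)
    joinable-map f f-mono (w , u↝*w , v↝*w) = f w , gmap f f-mono u↝*w , gmap f f-mono v↝*w

    joinable-in-one-step : ∀ {u v w} → u ↝ w → v ↝ w → Joinable u v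
    joinable-in-one-step u↝w v↝w = _ , return u↝w , return v↝w

    InSubstitution : Sub → Alg → Term → Set
    InSubstitution σ p v = ∃ λ σ' → σ ⇉* σ' × v ↝* subst σ' ⌜ p ⌝

    record Overlap (σ : Sub) (p : Alg) (v : Term) : Set where
      constructor overlapping
      field
        C : AlgCtx
        q : Alg
        C[q]≡p : aplug C q ≡ p
        l r : Term
        τ : Sub
        l→r : R l r
        σq≡τl : subst σ ⌜ q ⌝ ≡ subst τ l
        v≡C[τr] : v ≡ C ⟨ σ ∣ subst τ r ⟩

    ⇉*-update : ∀ σ {s i a} → σ s i ↝ a → σ ⇉* update σ (s , i) a
    ⇉*-update σ {s} {i} σx↝a s' i' with (s' , i') ≟ᵥ (s , i)
    ... | yes refl = return σx↝a
    ... | no _ = ε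

    inSubstitution-var : ∀ σ {s i v} → σ s i ↝ v → InSubstitution σ (avar s i) v
    inSubstitution-var σ {s} {i} {v} σx↝v =
      update σ (s , i) v , ⇉*-update σ σx↝v , transport (v ↝*_) (sym (update-same σ s i v)) ε

    inSubstitution-fun : ∀ σ {f} (as : Vec Alg (arity f)) k {u} →
      InSubstitution σ (lookup as k) u → InSubstitution σ (afun f as) (fun f (substV σ ⌜ as ⌝V [ k ]≔ u))
    inSubstitution-fun σ as k {u} (σ' , σ⇉*σ' , u↝*σ'a) =
      σ' , σ⇉*σ' ,
      ↝*-fun-pointwise-[]≔ _ _ k (⇉*-substV σ⇉*σ' ⌜ as ⌝V) (transport (u ↝*_) (sym lookup-σ'as) u↝*σ'a)
      where
        lookup-σ'as : lookup (substV σ' ⌜ as ⌝V) k ≡ subst σ' ⌜ lookup as k ⌝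
        lookup-σ'as = trans (lookup-substV σ' ⌜ as ⌝V k) (cong (subst σ') (lookup-⌜⌝V as k))

    overlap-fun : ∀ σ {f} (as : Vec Alg (arity f)) k {u} →
      Overlap σ (lookup as k) u → Overlap σ (afun f as) (fun f (substV σ ⌜ as ⌝V [ k ]≔ u))
    overlap-fun σ {f} as k (overlapping C q C[q]≡as[k] l r τ l→r σq≡τl u≡C[τr]) =
      overlapping (node f as k C) q
        (cong (afun f) (trans (cong (as [ k ]≔_) C[q]≡as[k]) (Vec.[]≔-lookup as k)))
        l r τ l→r σq≡τl (cong (λ x → fun f (substV σ ⌜ as ⌝V [ k ]≔ x)) u≡C[τr])

    mutual
      step-from-instance : ∀ σ p {v} → subst σ ⌜ p ⌝ ↝ v → InSubstitution σ p v ⊎ Overlap σ p v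
      step-from-instance σ (avar s i) σx↝v = inj₁ (inSubstitution-var σ σx↝v)
      step-from-instance σ (afun f as) (root (rule τ l→r σp≡τl v≡τr)) =
        inj₂ (overlapping hole (afun f as) refl _ _ τ l→r σp≡τl v≡τr)
      step-from-instance σ (afun f as) (fun k σas[k]↝u) =
        Sum.map (inSubstitution-fun σ as k) (overlap-fun σ as k) (step-from-instanceV σ as k σas[k]↝u)

      step-from-instanceV : ∀ σ {n} (as : Vec Alg n) k {u} →
        lookup (substV σ ⌜ as ⌝V) k ↝ u → InSubstitution σ (lookup as k) u ⊎ Overlap σ (lookup as k) u
      step-from-instanceV σ (a ∷ as) zero = step-from-instance σ a
      step-from-instanceV σ (a ∷ as) (suc k) = step-from-instanceV σ as k

    single-⇉* : ∀ b {a a'} → a ↝ a' → single b a ⇉* single b a'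
    single-⇉* ⋆ a↝a' ⋆ zero = return a↝a'
    single-⇉* ⋆ a↝a' ⋆ (suc i) = ε
    single-⇉* ⋆ a↝a' □ i = ε
    single-⇉* □ a↝a' ⋆ i = ε
    single-⇉* □ a↝a' □ zero = return a↝a'
    single-⇉* □ a↝a' □ (suc i) = ε

    -- Peaks

    module _ (isRule : ∀ l r → R l r → IsRewriteRule l r) (lcR : LocallyConfluentOn Algebraic (Closure R)) where

      lhs-pattern : ∀ {l r} → R l r → Σ Alg λ p → ⌜ p ⌝ ≡ l
      lhs-pattern {l} {r} l→r = alg⇒Alg (proj₁ (isRule l r l→r))

      lhs-instance-is-fun : ∀ {l r} → R l r → ∀ σ → ∃ λ f → ∃ λ ts → subst σ l ≡ fun f ts
      lhs-instance-is-fun {l} {r} l→r σ with isRule l r l→r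
      ... | l-alg , l-nonvar , _ with alg⇒Alg l-alg
      ... | avar s i , refl = ⊥-elim (l-nonvar (s , i , refl))
      ... | afun f as , refl = f , substV σ ⌜ as ⌝V , refl

      algebraic-peak-instance-joinable : ∀ θ {A u v} → Algebraic A →
        Closure R A u → Closure R A v → Joinable (subst θ u) (subst θ v)
      algebraic-peak-instance-joinable θ {A} A-alg A→u A→v with lcR A A-alg _ _ A→u A→v
      ... | w , u→*w , v→*w = subst θ w , instance* u→*w , instance* v→*w
        where
          instance* : ∀ {t u} → Star (Closure R) t u → subst θ t ↝* subst θ u
          instance* = gmap (subst θ) (↝-subst θ ∘ closure⇒↝ rule⇒root)

      overlap-joinable : ∀ {σ p l r v} → R l r → ⌜ p ⌝ ≡ l → Overlap σ p v → Joinable (subst σ r) v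
      overlap-joinable {σ} {r = r} l→r refl (overlapping C q refl l' r' τ l'→r' σq≡τl' refl)
        with lhs-pattern l'→r'
      ... | q' , refl =
        transport₂ Joinable μr-instance μ'r'-instance (algebraic-peak-instance-joinable θ A-alg A→μr A→μ'r')
        where
          open CommonAlgInstance (common-alg-instance σ q τ q' σq≡τl')
          open ≡-Reasoning
          A : Term
          A = subst ⌜ μ ⌝ˢ ⌜ aplug C q ⌝
          A-alg : Algebraic A
          A-alg = transport Algebraic (⌜asubst⌝ μ (aplug C q)) (⌜⌝-algebraic (asubst μ (aplug C q)))
          A→μr : Closure R A (subst ⌜ μ ⌝ˢ r)
          A→μr = subst⟨ ⌜ μ ⌝ˢ ⟩ (base l→r)
          A≡C[μ'l'] : A ≡ C ⟨ ⌜ μ ⌝ˢ ∣ subst ⌜ μ' ⌝ˢ ⌜ q' ⌝ ⟩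
          A≡C[μ'l'] = begin
            A                                          ≡⟨ subst-aplug ⌜ μ ⌝ˢ C q ⟩
            C ⟨ ⌜ μ ⌝ˢ ∣ subst ⌜ μ ⌝ˢ ⌜ q ⌝ ⟩          ≡⟨ cong (C ⟨ ⌜ μ ⌝ˢ ∣_⟩) (sym (⌜asubst⌝ μ q)) ⟩
            C ⟨ ⌜ μ ⌝ˢ ∣ ⌜ asubst μ q ⌝ ⟩              ≡⟨ cong (λ a → C ⟨ ⌜ μ ⌝ˢ ∣ ⌜ a ⌝ ⟩) unifies ⟩
            C ⟨ ⌜ μ ⌝ˢ ∣ ⌜ asubst μ' q' ⌝ ⟩            ≡⟨ cong (C ⟨ ⌜ μ ⌝ˢ ∣_⟩) (⌜asubst⌝ μ' q') ⟩
            C ⟨ ⌜ μ ⌝ˢ ∣ subst ⌜ μ' ⌝ˢ ⌜ q' ⌝ ⟩        ∎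
          A→μ'r' : Closure R A (C ⟨ ⌜ μ ⌝ˢ ∣ subst ⌜ μ' ⌝ˢ r' ⟩)
          A→μ'r' = transport (λ t → Closure R t (C ⟨ ⌜ μ ⌝ˢ ∣ subst ⌜ μ' ⌝ˢ r' ⟩)) (sym A≡C[μ'l'])
                     (closure-plug C ⌜ μ ⌝ˢ (subst⟨ ⌜ μ' ⌝ˢ ⟩ (base l'→r')))
          μr-instance : subst θ (subst ⌜ μ ⌝ˢ r) ≡ subst σ r
          μr-instance = trans (subst-subst θ ⌜ μ ⌝ˢ r) (subst-cong factorsˡ r)
          μ'r'-instance : subst θ (C ⟨ ⌜ μ ⌝ˢ ∣ subst ⌜ μ' ⌝ˢ r' ⟩) ≡ C ⟨ σ ∣ subst τ r' ⟩
          μ'r'-instance = begin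
            subst θ (C ⟨ ⌜ μ ⌝ˢ ∣ subst ⌜ μ' ⌝ˢ r' ⟩)            ≡⟨ subst-plug θ ⌜ μ ⌝ˢ C _ ⟩
            C ⟨ θ ∘ˢ ⌜ μ ⌝ˢ ∣ subst θ (subst ⌜ μ' ⌝ˢ r') ⟩        ≡⟨ plug-cong factorsˡ C _ ⟩
            C ⟨ σ ∣ subst θ (subst ⌜ μ' ⌝ˢ r') ⟩                 ≡⟨ cong (C ⟨ σ ∣_⟩) (subst-subst θ ⌜ μ' ⌝ˢ r') ⟩
            C ⟨ σ ∣ subst (θ ∘ˢ ⌜ μ' ⌝ˢ) r' ⟩                     ≡⟨ cong (C ⟨ σ ∣_⟩) (subst-cong factorsʳ r') ⟩
            C ⟨ σ ∣ subst τ r' ⟩                                 ∎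

      rule-peak : ∀ σ {l r v} → R l r → subst σ l ↝ v → Joinable (subst σ r) v
      rule-peak σ {l} {r} l→r σl↝v with lhs-pattern l→r
      ... | p , refl with step-from-instance σ p σl↝v
      ... | inj₁ (σ' , σ⇉*σ' , v↝*σ'l) =
        subst σ' r , ⇉*-subst σ⇉*σ' r , v↝*σ'l ◅◅ return (root (rule σ' l→r refl refl))
      ... | inj₂ σl≈v = overlap-joinable l→r refl σl≈v

      beta-peak : ∀ b U t a {v} → app (abs b U t) a ↝ v → Joinable (t [ b ≔ a ]) v
      beta-peak b U t a (root (rule τ l→r redex≡τl _)) with lhs-instance-is-fun l→r τ
      ... | _ , _ , τl≡fun with trans redex≡τl τl≡fun
      ... | ()
      beta-peak b U t a (root (beta _ _ _ _)) = _ , ε , ε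
      beta-peak b U t a (appˡ (root (rule τ l→r abs≡τl _))) with lhs-instance-is-fun l→r τ
      ... | _ , _ , τl≡fun with trans abs≡τl τl≡fun
      ... | ()
      beta-peak b U t a (appˡ (absˡ U↝U')) = _ , ε , return (root (beta b _ t a))
      beta-peak b U t a (appˡ (absʳ t↝t')) =
        joinable-in-one-step (↝-subst (single b a) t↝t') (root (beta b U _ a))
      beta-peak b U t a (appʳ a↝a') = _ , ⇉*-subst (single-⇉* b a↝a') t , return (root (beta b U t _))

      root-peak : ∀ {t u v} → RootStep t u → t ↝ v → Joinable u v
      root-peak (rule σ l→r refl refl) = rule-peak σ l→r
      root-peak (beta b U t a) = beta-peak b U t a

      ↝-locally-confluent : ∀ {t u v} → t ↝ u → t ↝ v → Joinable u v
      ↝-locally-confluent (root t→u) t↝v = root-peak t→u t↝v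
      ↝-locally-confluent t↝u (root t→v) = joinable-sym (root-peak t→v t↝u)
      ↝-locally-confluent (prodˡ d) (prodˡ e) = joinable-map _ prodˡ (↝-locally-confluent d e)
      ↝-locally-confluent (prodˡ d) (prodʳ e) = joinable-in-one-step (prodʳ e) (prodˡ d)
      ↝-locally-confluent (prodʳ d) (prodˡ e) = joinable-in-one-step (prodˡ e) (prodʳ d)
      ↝-locally-confluent (prodʳ d) (prodʳ e) = joinable-map _ prodʳ (↝-locally-confluent d e)
      ↝-locally-confluent (absˡ d) (absˡ e) = joinable-map _ absˡ (↝-locally-confluent d e)
      ↝-locally-confluent (absˡ d) (absʳ e) = joinable-in-one-step (absʳ e) (absˡ d)
      ↝-locally-confluent (absʳ d) (absˡ e) = joinable-in-one-step (absˡ e) (absʳ d)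
      ↝-locally-confluent (absʳ d) (absʳ e) = joinable-map _ absʳ (↝-locally-confluent d e)
      ↝-locally-confluent (appˡ d) (appˡ e) = joinable-map _ appˡ (↝-locally-confluent d e)
      ↝-locally-confluent (appˡ d) (appʳ e) = joinable-in-one-step (appʳ e) (appˡ d)
      ↝-locally-confluent (appʳ d) (appˡ e) = joinable-in-one-step (appˡ e) (appʳ d)
      ↝-locally-confluent (appʳ d) (appʳ e) = joinable-map _ appʳ (↝-locally-confluent d e)
      ↝-locally-confluent (fun {ts = ts} k d) (fun k' e) with k' Fin.≟ k
      ... | yes refl = joinable-map _ (↝-fun[]≔ ts k) (↝-locally-confluent d e)
      ... | no k'≢k = joinable-in-one-step
        (↝-fun-lookup k' (Vec.lookup∘update′ k'≢k ts _) e)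
        (transport (λ ts' → _ ↝ fun _ ts') (sym (Vec.[]≔-commutes ts k k' (k'≢k ∘ sym)))
          (↝-fun-lookup k (Vec.lookup∘update′ (k'≢k ∘ sym) ts _) d))

mainTheorem3 : (F : Set) (arity : F → ℕ) →
    let open Terms F arity in
    (R : Term → Term → Set) →
    (∀ l r → R l r → IsRewriteRule l r) →
    LocallyConfluentOn Algebraic (λ t u → t ⟶[ R ] u) →
    LocallyConfluentOn AllTerms (λ t u → t ⟶[ R ]∪β u)
mainTheorem3 F arity R isRule lcR _ _ u v t⟶u t⟶v
  with ↝-locally-confluent R isRule lcR (⟶⇒↝ R t⟶u) (⟶⇒↝ R t⟶v)
... | w , u↝*w , v↝*w = w , ↝*⇒⟶* R u↝*w , ↝*⇒⟶* R v↝*w
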